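{- If $G$ is a graph of diameter $2$ with maximum degree $\Delta$, then $\lambda(M(G))\leq 2(\Delta^2+1)$.
   Context: An $L(2,1)$-labeling of $G$ is a map $f:V\to\{0,1,2,\dots\}$ with $|f(x)-f(y)|\ge 2$ if $d_G(x,y)=1$ and $|f(x)-f(y)|\ge1$ if $d_G(x,y)=2$; $\lambda(G)$ is the minimum over such $f$ of the largest label. For $V=\{v_1,\dots,v_n\}$, $M(G)$ has vertex set $V\cup\{v_1',\dots,v_n'\}\cup\{u\}$ and edge set $E\cup\{v_iv_j' : v_iv_j\in E\}\cup\{v_i'u: 1\le i\le n\}$. -}

module Defs where

open import Data.Nat using (ℕ; _+_; _≤_; _⊔_)
open import Data.Bool using (Bool; true; false; if_then_else_)
open import Data.Fin using (Fin)
open import Data.List using (List; map; foldr; allFin)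
open import Data.Nat.ListAction using (sum)
open import Data.Sum using (_⊎_; inj₁; inj₂)
open import Data.Unit using (⊤; tt)
open import Data.Product using (_×_; ∃)
open import Relation.Binary.PropositionalEquality using (_≡_; _≢_)

record Graph (n : ℕ) : Set where
  field
    adj    : Fin n → Fin n → Bool
    sym    : ∀ i j → adj i j ≡ adj j i
    irrefl : ∀ i → adj i i ≡ false
open Graph public

degree : ∀ {n} → Graph n → Fin n → ℕ
degree {n} G v = sum (map (λ w → if adj G v w then 1 else 0) (allFin n))

maxDegree : ∀ {n} → Graph n → ℕ
maxDegree {n} G = foldr _⊔_ 0 (map (degree G) (allFin n))

Dist1 : {V : Set} → (V → V → Bool) → V → V → Set
Dist1 A x y = A x y ≡ true

Dist2 : {V : Set} → (V → V → Bool) → V → V → Set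
Dist2 A x y = x ≢ y × A x y ≡ false × ∃ (λ z → A x z ≡ true × A z y ≡ true)

Diameter2 : ∀ {n} → Graph n → Set
Diameter2 {n} G =
  (∀ (x y : Fin n) → x ≢ y → Dist1 (adj G) x y ⊎ Dist2 (adj G) x y)
  × ∃ (λ x → ∃ (λ y → Dist2 (adj G) x y))

Gap2 : ℕ → ℕ → Set
Gap2 a b = (a + 2 ≤ b) ⊎ (b + 2 ≤ a)

IsL21 : {V : Set} → (V → V → Bool) → (V → ℕ) → Set
IsL21 A f =
  (∀ x y → Dist1 A x y → Gap2 (f x) (f y))
  × (∀ x y → Dist2 A x y → f x ≢ f y)

LambdaAtMost : {V : Set} → (V → V → Bool) → ℕ → Set
LambdaAtMost {V} A k = ∃ (λ (f : V → ℕ) → IsL21 A f × (∀ v → f v ≤ k))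

-- The graph M(G): vertices v_i = inj₁ i, v_i' = inj₂ (inj₁ i), u = inj₂ (inj₂ tt).
MVert : ℕ → Set
MVert n = Fin n ⊎ (Fin n ⊎ ⊤)

MAdj : ∀ {n} → Graph n → MVert n → MVert n → Bool
MAdj G (inj₁ i)        (inj₁ j)        = adj G i j
MAdj G (inj₁ i)        (inj₂ (inj₁ j)) = adj G i j
MAdj G (inj₂ (inj₁ j)) (inj₁ i)        = adj G i j
MAdj G (inj₂ (inj₁ j)) (inj₂ (inj₂ _)) = true
MAdj G (inj₂ (inj₂ _)) (inj₂ (inj₁ j)) = true
MAdj G (inj₁ _)        (inj₂ (inj₂ _)) = false
MAdj G (inj₂ (inj₂ _)) (inj₁ _)        = false
MAdj G (inj₂ (inj₁ _)) (inj₂ (inj₁ _)) = false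
MAdj G (inj₂ (inj₂ _)) (inj₂ (inj₂ _)) = false

-- Label M(G) along a walk that starts at u and visits every v_i and v_i′, adding 2 to the label
-- across an edge of M(G) and 1 otherwise: such a labelling is injective and 2-separated on edges,
-- so it is an L(2,1)-labelling whose largest label is 2n plus the number of edges the walk crosses.
-- Split V(G) greedily into pairs of non-adjacent vertices and a clique, start the walk with
-- u v_a v_a′ for a vertex a of the clique (or of a pair, whose partner then goes last), and run
-- through the pairs, then the rest of the clique two at a time, each couple {y , z} as
-- v_y′ v_y v_z v_z′. Only steps v_y v_z inside the clique can cross an edge, so the largest
-- label is at most 2n + (clique size - 1). Counting the vertices at distance at most 2 from a,
-- each neighbour of a has at most Δ - 1 neighbours outside N[a], and at most Δ - 2 if it has
-- another neighbour in N(a); applied to the clique this gives n + (clique size - 1) ≤ Δ² + 1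
-- when the clique has at least three vertices, and the Moore bound n ≤ Δ² + 1 always.

module Submission where

open import Defs hiding (sym)
open import Data.Bool using (Bool; true; false; if_then_else_; not; _∧_; _∨_)
open import Data.Bool.Properties using (∨-zeroʳ)
open import Data.Empty using (⊥-elim)
open import Data.Fin using (Fin; zero; suc)
open import Data.Fin.Properties using (_≟_)
open import Data.List using (List; []; _∷_; _++_; length; foldr; tabulate; allFin)
open import Data.List.Properties using (map-tabulate; length-tabulate)
open import Data.List.Membership.Propositional using (_∈_)
open import Data.List.Membership.Propositional.Properties using (∈-map⁺; ∈-allFin)
open import Data.List.Relation.Binary.Permutation.Propositional
  using (_↭_; ↭-refl; ↭-prep; ↭-swap; ↭-sym; ↭-trans)
open import Data.List.Relation.Binary.Permutation.Propositional.Properties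
  using (All-resp-↭; ∈-resp-↭; ↭-length; shift; ++⁺ˡ)
open import Data.List.Relation.Unary.All as All using (All; []; _∷_)
open import Data.List.Relation.Unary.AllPairs as AllPairs using (AllPairs; []; _∷_)
open import Data.List.Relation.Unary.Any as Any using (here; there)
open import Data.List.Relation.Unary.Unique.Propositional using (Unique)
open import Data.Nat using (ℕ; zero; suc; _+_; _*_; _^_; _⊔_; _≤_; _<_; z≤n; s≤s)
import Data.Nat.ListAction as List
open import Data.Nat.Properties hiding (_≟_)
open import Data.Nat.Tactic.RingSolver using (solve-∀)
open import Data.Product as Product using (_×_; _,_; proj₁; proj₂; ∃; ∃₂)
open import Data.Sum using (_⊎_; inj₁; inj₂; swap)
open import Data.Sum.Properties using (≡-dec)
open import Data.Unit using (tt)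
import Data.Unit.Properties as Unit
open import Function using (_∘_; id)
open import Relation.Binary.Definitions using (DecidableEquality)
open import Relation.Binary.PropositionalEquality
open import Relation.Nullary using (does; yes; no)
open import Relation.Nullary.Decidable using (dec-true)
open import Algebra.Properties.Semiring.Sum +-*-semiring
  using (sum; sum-syntax; ∑-distrib-+; ∑-comm; *-distribˡ-sum; sum-cong-≗)

⟦_⟧ : Bool → ℕ
⟦ b ⟧ = if b then 1 else 0

⟦⟧≤1 : ∀ b → ⟦ b ⟧ ≤ 1
⟦⟧≤1 false = z≤n
⟦⟧≤1 true  = ≤-refl

∑-mono-≤ : ∀ {n} {f g : Fin n → ℕ} → (∀ i → f i ≤ g i) → sum f ≤ sum g
∑-mono-≤ {zero}  f≤g = z≤n
∑-mono-≤ {suc n} f≤g = +-mono-≤ (f≤g zero) (∑-mono-≤ (f≤g ∘ suc))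

lookup≤∑ : ∀ {n} (f : Fin n → ℕ) i → f i ≤ sum f
lookup≤∑ f zero    = m≤m+n _ _
lookup≤∑ f (suc i) = ≤-trans (lookup≤∑ (f ∘ suc) i) (m≤n+m _ _)

lookup+lookup≤∑ : ∀ {n} (f : Fin n → ℕ) {i j} → i ≢ j → f i + f j ≤ sum f
lookup+lookup≤∑ f {zero}  {zero}  i≢j = ⊥-elim (i≢j refl)
lookup+lookup≤∑ f {zero}  {suc j} _   = +-monoʳ-≤ (f zero) (lookup≤∑ (f ∘ suc) j)
lookup+lookup≤∑ f {suc i} {zero}  _   =
  ≤-trans (≤-reflexive (+-comm (f (suc i)) (f zero))) (+-monoʳ-≤ (f zero) (lookup≤∑ (f ∘ suc) i))
lookup+lookup≤∑ f {suc i} {suc j} i≢j =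
  ≤-trans (lookup+lookup≤∑ (f ∘ suc) (i≢j ∘ cong suc)) (m≤n+m _ _)

∑1≡n : ∀ n → ∑[ i < n ] 1 ≡ n
∑1≡n zero    = refl
∑1≡n (suc n) = cong suc (∑1≡n n)

∑⟦≟⟧≡1 : ∀ {n} (v : Fin n) → ∑[ x < n ] ⟦ does (x ≟ v) ⟧ ≡ 1
∑⟦≟⟧≡1 {suc n} zero    = cong suc (∑⟦suc≟zero⟧≡0 n)
  where
  ∑⟦suc≟zero⟧≡0 : ∀ n → ∑[ x < n ] ⟦ does (suc x ≟ zero {n}) ⟧ ≡ 0
  ∑⟦suc≟zero⟧≡0 zero    = refl
  ∑⟦suc≟zero⟧≡0 (suc n) = ∑⟦suc≟zero⟧≡0 n
∑⟦≟⟧≡1 {suc n} (suc v) = ∑⟦≟⟧≡1 v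

sum-tabulate : ∀ {n} (f : Fin n → ℕ) → List.sum (tabulate f) ≡ sum f
sum-tabulate {zero}  f = refl
sum-tabulate {suc n} f = cong (f zero +_) (sum-tabulate (f ∘ suc))

module _ {n : ℕ} where

  open import Data.List.Membership.DecPropositional (_≟_ {n}) using (_∈?_)

  length≤∑⟦∈?⟧ : ∀ {K : List (Fin n)} → Unique K → length K ≤ ∑[ x < n ] ⟦ does (x ∈? K) ⟧
  length≤∑⟦∈?⟧ {[]}    []           = z≤n
  length≤∑⟦∈?⟧ {k ∷ K} (k∉K ∷ uniq) = begin
    suc (length K)
      ≡⟨ cong (λ b → ⟦ b ⟧ + length K) (dec-true (k ≟ k) refl) ⟨
    ⟦ does (k ≟ k) ⟧ + length K
      ≤⟨ +-mono-≤ (lookup≤∑ (λ x → ⟦ does (x ≟ k) ⟧) k) (length≤∑⟦∈?⟧ uniq) ⟩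
    ∑[ x < n ] ⟦ does (x ≟ k) ⟧ + ∑[ x < n ] ⟦ does (x ∈? K) ⟧
      ≡⟨ ∑-distrib-+ {n} _ _ ⟨
    ∑[ x < n ] (⟦ does (x ≟ k) ⟧ + ⟦ does (x ∈? K) ⟧)
      ≤⟨ ∑-mono-≤ disjoint ⟩
    ∑[ x < n ] ⟦ does (x ∈? (k ∷ K)) ⟧
      ∎
    where
    open ≤-Reasoning
    disjoint : ∀ x → ⟦ does (x ≟ k) ⟧ + ⟦ does (x ∈? K) ⟧ ≤ ⟦ does (x ∈? (k ∷ K)) ⟧
    disjoint x with x ≟ k | x ∈? K
    ... | yes refl | yes x∈K = ⊥-elim (All.lookup k∉K x∈K refl)
    ... | yes _    | no _    = ≤-refl
    ... | no _     | _       = ≤-refl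

≤-foldr-⊔ : ∀ {m ms} → m ∈ ms → m ≤ foldr _⊔_ 0 ms
≤-foldr-⊔ (here refl)              = m≤m⊔n _ _
≤-foldr-⊔ {ms = k ∷ _} (there m∈) = m≤n⇒m≤o⊔n k (≤-foldr-⊔ m∈)

double-bound : ∀ n {e m d} → e ≤ m → n + m ≤ 1 + d → 2 * n + e ≤ 2 * (d + 1)
double-bound n {e} {m} {d} e≤m n+m≤1+d = begin
  2 * n + e          ≤⟨ +-monoʳ-≤ (2 * n) (≤-trans e≤m (m≤m+n m m)) ⟩
  2 * n + (m + m)    ≡⟨ distrib n m ⟩
  2 * (n + m)        ≤⟨ *-monoʳ-≤ 2 n+m≤1+d ⟩
  2 * (1 + d)        ≡⟨ cong (2 *_) (+-comm 1 d) ⟩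
  2 * (d + 1)        ∎
  where
  open ≤-Reasoning
  distrib : ∀ n m → 2 * n + (m + m) ≡ 2 * (n + m)
  distrib = solve-∀

adjacent⇒≢ : {V : Set} {A : V → V → Bool} → (∀ x → A x x ≡ false) → ∀ {x y} → A x y ≡ true → x ≢ y
adjacent⇒≢ irrefl {x} e refl with () ← trans (sym e) (irrefl x)

DiameterAtMost2 : ∀ {n} → Graph n → Set
DiameterAtMost2 {n} G = ∀ (x y : Fin n) → x ≢ y → Dist1 (adj G) x y ⊎ Dist2 (adj G) x y

module _ {n : ℕ} (G : Graph n) where

  private
    A = adj G
    Δ = maxDegree G
  open import Data.List.Membership.DecPropositional (_≟_ {n}) using (_∈?_)

  degree≡∑ : ∀ v → degree G v ≡ ∑[ x < n ] ⟦ A v x ⟧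
  degree≡∑ v = trans (cong List.sum (map-tabulate id (λ x → ⟦ A v x ⟧))) (sum-tabulate (λ x → ⟦ A v x ⟧))

  degree≤maxDegree : ∀ v → degree G v ≤ Δ
  degree≤maxDegree v = ≤-foldr-⊔ (∈-map⁺ (degree G) (∈-allFin v))

  InTriangleWith : Fin n → Fin n → Set
  InTriangleWith v w = A v w ≡ true × ∃ λ k → A w k ≡ true × A v k ≡ true

  closedNbhd : Fin n → Fin n → Bool
  closedNbhd v x = does (x ≟ v) ∨ A v x

  closedNbhd-self : ∀ v → closedNbhd v v ≡ true
  closedNbhd-self v rewrite dec-true (v ≟ v) refl = refl

  closedNbhd-adj : ∀ {v x} → A v x ≡ true → closedNbhd v x ≡ true
  closedNbhd-adj {v} {x} e rewrite e = ∨-zeroʳ (does (x ≟ v))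

  inside outside : Fin n → Fin n → ℕ
  inside  v w = ∑[ x < n ] ⟦ A w x ∧ closedNbhd v x ⟧
  outside v w = ∑[ x < n ] ⟦ A w x ∧ not (closedNbhd v x) ⟧

  degree≡inside+outside : ∀ v w → degree G w ≡ inside v w + outside v w
  degree≡inside+outside v w = begin
    degree G w
      ≡⟨ degree≡∑ w ⟩
    ∑[ x < n ] ⟦ A w x ⟧
      ≡⟨ sum-cong-≗ (λ x → split (A w x) (closedNbhd v x)) ⟩
    ∑[ x < n ] (⟦ A w x ∧ closedNbhd v x ⟧ + ⟦ A w x ∧ not (closedNbhd v x) ⟧)
      ≡⟨ ∑-distrib-+ {n} _ _ ⟩
    inside v w + outside v w
      ∎
    where
    open ≡-Reasoning
    split : ∀ a b → ⟦ a ⟧ ≡ ⟦ a ∧ b ⟧ + ⟦ a ∧ not b ⟧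
    split false _     = refl
    split true  true  = refl
    split true  false = refl

  ⟦adj∧closedNbhd⟧≡1 : ∀ {v w x} → A w x ≡ true → closedNbhd v x ≡ true → ⟦ A w x ∧ closedNbhd v x ⟧ ≡ 1
  ⟦adj∧closedNbhd⟧≡1 e e′ rewrite e | e′ = refl

  1≤inside : ∀ {v w} → A v w ≡ true → 1 ≤ inside v w
  1≤inside {v} {w} e = begin
    1                            ≡⟨ ⟦adj∧closedNbhd⟧≡1 (trans (Graph.sym G w v) e) (closedNbhd-self v) ⟨
    ⟦ A w v ∧ closedNbhd v v ⟧   ≤⟨ lookup≤∑ (λ x → ⟦ A w x ∧ closedNbhd v x ⟧) v ⟩
    inside v w                   ∎
    where open ≤-Reasoning

  2≤inside : ∀ {v w} → InTriangleWith v w → 2 ≤ inside v w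
  2≤inside {v} {w} (e , k , ewk , evk) = begin
    2
      ≡⟨ cong₂ _+_ (⟦adj∧closedNbhd⟧≡1 (trans (Graph.sym G w v) e) (closedNbhd-self v))
                   (⟦adj∧closedNbhd⟧≡1 ewk (closedNbhd-adj evk)) ⟨
    ⟦ A w v ∧ closedNbhd v v ⟧ + ⟦ A w k ∧ closedNbhd v k ⟧
      ≤⟨ lookup+lookup≤∑ (λ x → ⟦ A w x ∧ closedNbhd v x ⟧) (adjacent⇒≢ (Graph.irrefl G) evk) ⟩
    inside v w
      ∎
    where open ≤-Reasoning

  n≤1+degree+∑outside : DiameterAtMost2 G → ∀ v → n ≤ 1 + degree G v + ∑[ w < n ] (⟦ A v w ⟧ * outside v w)
  n≤1+degree+∑outside diam v = begin
    n
      ≡⟨ ∑1≡n n ⟨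
    ∑[ x < n ] 1
      ≤⟨ ∑-mono-≤ cover ⟩
    ∑[ x < n ] (⟦ does (x ≟ v) ⟧ + ⟦ A v x ⟧ + ∑[ w < n ] viaNeighbour w x)
      ≡⟨ ∑-distrib-+ {n} _ _ ⟩
    ∑[ x < n ] (⟦ does (x ≟ v) ⟧ + ⟦ A v x ⟧) + ∑[ x < n ] ∑[ w < n ] viaNeighbour w x
      ≡⟨ cong₂ _+_ (trans (∑-distrib-+ {n} _ _) (cong₂ _+_ (∑⟦≟⟧≡1 v) (sym (degree≡∑ v))))
                   (∑-comm {n} {n} (λ x w → viaNeighbour w x)) ⟩
    1 + degree G v + ∑[ w < n ] ∑[ x < n ] viaNeighbour w x
      ≡⟨ cong (1 + degree G v +_)
              (sum-cong-≗ (λ w → *-distribˡ-sum ⟦ A v w ⟧ (λ x → ⟦ A w x ∧ not (closedNbhd v x) ⟧))) ⟨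
    1 + degree G v + ∑[ w < n ] (⟦ A v w ⟧ * outside v w)
      ∎
    where
    open ≤-Reasoning
    viaNeighbour : Fin n → Fin n → ℕ
    viaNeighbour w x = ⟦ A v w ⟧ * ⟦ A w x ∧ not (closedNbhd v x) ⟧
    cover : ∀ x → 1 ≤ ⟦ does (x ≟ v) ⟧ + ⟦ A v x ⟧ + ∑[ w < n ] viaNeighbour w x
    cover x with x ≟ v
    ... | yes _ = s≤s z≤n
    ... | no x≢v with A v x in evx
    ...   | true  = s≤s z≤n
    ...   | false with diam v x (x≢v ∘ sym)
    ...     | inj₁ evx′ with () ← trans (sym evx) evx′
    ...     | inj₂ (_ , _ , z , evz , ezx) = ≤-trans (≤-reflexive (sym via-z)) (lookup≤∑ _ z)
      where
      -- the with-abstractions have already reduced not (closedNbhd v x) to true in the goal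
      via-z : ⟦ A v z ⟧ * ⟦ A z x ∧ true ⟧ ≡ 1
      via-z rewrite evz | ezx = refl

  outside+i≤Δ : ∀ {v w i} → i ≤ inside v w → 1 * outside v w + i ≤ Δ * 1
  outside+i≤Δ {v} {w} {i} i≤inside = begin
    1 * outside v w + i        ≡⟨ cong (_+ i) (*-identityˡ _) ⟩
    outside v w + i            ≤⟨ +-monoʳ-≤ (outside v w) i≤inside ⟩
    outside v w + inside v w   ≡⟨ trans (+-comm (outside v w) (inside v w)) (sym (degree≡inside+outside v w)) ⟩
    degree G w                 ≤⟨ degree≤maxDegree w ⟩
    Δ                          ≡⟨ *-identityʳ Δ ⟨
    Δ * 1                      ∎
    where open ≤-Reasoning

  module _ {v : Fin n} {K : List (Fin n)} (triangles : All (InTriangleWith v) K) where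

    outside-neighbour-bound : ∀ w →
      ⟦ A v w ⟧ * outside v w + (⟦ A v w ⟧ + ⟦ does (w ∈? K) ⟧) ≤ Δ * ⟦ A v w ⟧
    outside-neighbour-bound w with A v w in evw | w ∈? K
    ... | false | no _    = z≤n
    ... | false | yes w∈K with () ← trans (sym evw) (proj₁ (All.lookup triangles w∈K))
    ... | true  | no _    = outside+i≤Δ (1≤inside evw)
    ... | true  | yes w∈K = outside+i≤Δ (2≤inside (All.lookup triangles w∈K))

    ∑outside+degree+∑K≤Δ*degree :
      ∑[ w < n ] (⟦ A v w ⟧ * outside v w) + (degree G v + ∑[ w < n ] ⟦ does (w ∈? K) ⟧) ≤ Δ * degree G v
    ∑outside+degree+∑K≤Δ*degree = begin
      X + (degree G v + S)
        ≡⟨ cong (λ d → X + (d + S)) (degree≡∑ v) ⟩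
      X + (∑[ w < n ] ⟦ A v w ⟧ + S)
        ≡⟨ cong (X +_) (∑-distrib-+ {n} _ _) ⟨
      X + ∑[ w < n ] (⟦ A v w ⟧ + ⟦ does (w ∈? K) ⟧)
        ≡⟨ ∑-distrib-+ {n} _ _ ⟨
      ∑[ w < n ] (⟦ A v w ⟧ * outside v w + (⟦ A v w ⟧ + ⟦ does (w ∈? K) ⟧))
        ≤⟨ ∑-mono-≤ outside-neighbour-bound ⟩
      ∑[ w < n ] (Δ * ⟦ A v w ⟧)
        ≡⟨ *-distribˡ-sum Δ (λ w → ⟦ A v w ⟧) ⟨
      Δ * ∑[ w < n ] ⟦ A v w ⟧
        ≡⟨ cong (Δ *_) (degree≡∑ v) ⟨
      Δ * degree G v
        ∎
      where
      open ≤-Reasoning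
      X S : ℕ
      X = ∑[ w < n ] (⟦ A v w ⟧ * outside v w)
      S = ∑[ w < n ] ⟦ does (w ∈? K) ⟧

  refined-moore-bound : DiameterAtMost2 G → ∀ v {K} → Unique K → All (InTriangleWith v) K →
                        n + length K ≤ 1 + Δ ^ 2
  refined-moore-bound diam v {K} uniq triangles = begin
    n + length K                   ≤⟨ +-mono-≤ (n≤1+degree+∑outside diam v) (length≤∑⟦∈?⟧ uniq) ⟩
    1 + degree G v + X + S         ≡⟨ rearrange (degree G v) X S ⟩
    1 + (X + (degree G v + S))     ≤⟨ s≤s (∑outside+degree+∑K≤Δ*degree triangles) ⟩
    1 + Δ * degree G v             ≤⟨ s≤s (*-monoʳ-≤ Δ (degree≤maxDegree v)) ⟩
    1 + Δ * Δ                      ≡⟨ cong (λ m → 1 + Δ * m) (*-identityʳ Δ) ⟨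
    1 + Δ ^ 2                      ∎
    where
    open ≤-Reasoning
    X S : ℕ
    X = ∑[ w < n ] (⟦ A v w ⟧ * outside v w)
    S = ∑[ w < n ] ⟦ does (w ∈? K) ⟧
    rearrange : ∀ d x s → 1 + d + x + s ≡ 1 + (x + (d + s))
    rearrange = solve-∀

module WalkLabelling {V : Set} (_≟ᵥ_ : DecidableEquality V) (A : V → V → Bool)
                     (A-sym : ∀ x y → A x y ≡ A y x) (A-irrefl : ∀ x → A x x ≡ false) where

  step : V → V → ℕ
  step a b = suc ⟦ A a b ⟧

  -- The label of the first visit to x by the walk a ∷ W whose labels start at c
  -- (junk, the last label, if x is not visited).
  label : ℕ → V → List V → V → ℕ
  label c a []      x = c
  label c a (b ∷ W) x with x ≟ᵥ a
  ... | yes _ = c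
  ... | no _  = label (c + step a b) b W x

  span : V → List V → ℕ
  span a []      = 0
  span a (b ∷ W) = step a b + span b W

  label≤span : ∀ c a W x → label c a W x ≤ c + span a W
  label≤span c a []      x = m≤m+n c 0
  label≤span c a (b ∷ W) x with x ≟ᵥ a
  ... | yes _ = m≤m+n c _
  ... | no _  = ≤-trans (label≤span (c + step a b) b W x) (≤-reflexive (+-assoc c (step a b) (span b W)))

  c≤label : ∀ c a W x → c ≤ label c a W x
  c≤label c a []      x = ≤-refl
  c≤label c a (b ∷ W) x with x ≟ᵥ a
  ... | yes _ = ≤-refl
  ... | no _  = ≤-trans (m≤m+n c _) (c≤label (c + step a b) b W x)

  label-head : ∀ c a W → label c a W a ≡ c
  label-head c a []      = refl
  label-head c a (b ∷ W) with a ≟ᵥ a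
  ... | yes _  = refl
  ... | no a≢a = ⊥-elim (a≢a refl)

  label-later : ∀ c a W {x} → x ≢ a → x ∈ W → c < label c a W x
  label-later c a (b ∷ W) {x} x≢a _ with x ≟ᵥ a
  ... | yes x≡a = ⊥-elim (x≢a x≡a)
  ... | no _    = <-≤-trans (m<m+n c (s≤s z≤n)) (c≤label (c + step a b) b W x)

  Separated : V → V → ℕ → ℕ → Set
  Separated x y m k = (x ≢ y → m ≢ k) × (A x y ≡ true → Gap2 m k)

  separated-self : ∀ {x m} → Separated x x m m
  separated-self = (λ x≢x → ⊥-elim (x≢x refl)) , (λ e → ⊥-elim (adjacent⇒≢ {A = A} A-irrefl e refl))

  separated-sym : ∀ {x y m k} → Separated x y m k → Separated y x k m
  separated-sym {x} {y} (distinct , gap) =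
    (λ y≢x k≡m → distinct (y≢x ∘ sym) (sym k≡m)) , (λ e → swap (gap (trans (A-sym x y) e)))

  head-separated : ∀ c a b W {y} → y ≢ a → y ∈ b ∷ W → Separated a y c (label (c + step a b) b W y)
  head-separated c a b W {y} _ y∈ =
    (λ _ → <⇒≢ (<-≤-trans (m<m+n c (s≤s z≤n)) (c≤label (c + step a b) b W y))) , (λ e → inj₁ (gap e))
    where
    gap : A a y ≡ true → c + 2 ≤ label (c + step a b) b W y
    gap e with y ≟ᵥ b
    ... | yes refl = ≤-reflexive (trans (cong (λ s → c + suc ⟦ s ⟧) (sym e)) (sym (label-head _ y W)))
    ... | no y≢b   = begin
      c + 2                        ≡⟨ +-suc c 1 ⟩
      suc (c + 1)                  ≤⟨ s≤s (+-monoʳ-≤ c (s≤s z≤n)) ⟩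
      suc (c + step a b)           ≤⟨ label-later (c + step a b) b W y≢b (Any.tail y≢b y∈) ⟩
      label (c + step a b) b W y   ∎
      where open ≤-Reasoning

  label-separated : ∀ c a W {x y} → x ∈ a ∷ W → y ∈ a ∷ W →
                    Separated x y (label c a W x) (label c a W y)
  label-separated c a []      (here refl) (here refl) = separated-self
  label-separated c a (b ∷ W) {x} {y} x∈ y∈ with x ≟ᵥ a | y ≟ᵥ a
  ... | yes refl | yes refl = separated-self
  ... | yes refl | no y≢a   = head-separated c a b W y≢a (Any.tail y≢a y∈)
  ... | no x≢a   | yes refl = separated-sym (head-separated c a b W x≢a (Any.tail x≢a x∈))
  ... | no x≢a   | no y≢a   = label-separated (c + step a b) b W (Any.tail x≢a x∈) (Any.tail y≢a y∈)

  walk-isL21 : ∀ c a W → (∀ x → x ∈ a ∷ W) → IsL21 A (label c a W)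
  walk-isL21 c a W visits =
    (λ x y d₁ → proj₂ (separated x y) d₁) , (λ x y d₂ → proj₁ (separated x y) (proj₁ d₂))
    where
    separated : ∀ x y → Separated x y (label c a W x) (label c a W y)
    separated x y = label-separated c a W (visits x) (visits y)

module CliquePairing {V : Set} (A : V → V → Bool) where

  Adjacent : V → V → Set
  Adjacent x y = A x y ≡ true

  unpair : List (V × V) → List V
  unpair []            = []
  unpair ((p , q) ∷ P) = p ∷ q ∷ unpair P

  record CliqueAndPairs (xs : List V) : Set where
    field
      pairs             : List (V × V)
      clique            : List V
      pairs-nonadjacent : All (λ (p , q) → A p q ≡ false) pairs
      clique-isClique   : AllPairs Adjacent clique
      partition         : unpair pairs ++ clique ↭ xs

  removeNonNeighbour : ∀ x K → AllPairs Adjacent K →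
    All (Adjacent x) K ⊎ ∃₂ λ r K′ → A x r ≡ false × K ↭ r ∷ K′ × AllPairs Adjacent K′
  removeNonNeighbour x []      _          = inj₁ []
  removeNonNeighbour x (k ∷ K) (k~K ∷ cK) with A x k in e
  ... | false = inj₂ (k , K , e , ↭-refl , cK)
  ... | true with removeNonNeighbour x K cK
  ...   | inj₁ x~K                     = inj₁ (e ∷ x~K)
  ...   | inj₂ (r , K′ , e′ , σ , cK′) =
          inj₂ (r , k ∷ K′ , e′ , ↭-trans (↭-prep k σ) (↭-swap k r ↭-refl)
               , All.tail (All-resp-↭ σ k~K) ∷ cK′)

  cliqueAndPairs : ∀ xs → CliqueAndPairs xs
  cliqueAndPairs []       = record
    { pairs = [] ; clique = [] ; pairs-nonadjacent = [] ; clique-isClique = [] ; partition = ↭-refl }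
  cliqueAndPairs (x ∷ xs) with cliqueAndPairs xs
  ... | record { pairs = P ; clique = K ; pairs-nonadjacent = nonadj ; clique-isClique = cK ; partition = σ }
    with removeNonNeighbour x K cK
  ...   | inj₁ x~K = record
    { pairs = P ; clique = x ∷ K ; pairs-nonadjacent = nonadj ; clique-isClique = x~K ∷ cK
    ; partition = ↭-trans (shift x (unpair P) K) (↭-prep x σ) }
  ...   | inj₂ (r , K′ , e , ρ , cK′) = record
    { pairs = (x , r) ∷ P ; clique = K′ ; pairs-nonadjacent = e ∷ nonadj ; clique-isClique = cK′
    ; partition = ↭-prep x (↭-trans (↭-sym (shift r (unpair P) K′))
                                    (↭-trans (++⁺ˡ (unpair P) (↭-sym ρ)) σ)) }

module _ {n : ℕ} (G : Graph n) where

  private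
    A = adj G
    Δ = maxDegree G

  apex : MVert n
  apex = inj₂ (inj₂ tt)

  base copy : Fin n → MVert n
  base x = inj₁ x
  copy x = inj₂ (inj₁ x)

  MAdj-sym : ∀ x y → MAdj G x y ≡ MAdj G y x
  MAdj-sym (inj₁ i)        (inj₁ j)        = Graph.sym G i j
  MAdj-sym (inj₁ i)        (inj₂ (inj₁ j)) = refl
  MAdj-sym (inj₁ i)        (inj₂ (inj₂ _)) = refl
  MAdj-sym (inj₂ (inj₁ i)) (inj₁ j)        = refl
  MAdj-sym (inj₂ (inj₁ i)) (inj₂ (inj₁ j)) = refl
  MAdj-sym (inj₂ (inj₁ i)) (inj₂ (inj₂ _)) = refl
  MAdj-sym (inj₂ (inj₂ _)) (inj₁ j)        = refl
  MAdj-sym (inj₂ (inj₂ _)) (inj₂ (inj₁ j)) = refl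
  MAdj-sym (inj₂ (inj₂ _)) (inj₂ (inj₂ _)) = refl

  MAdj-irrefl : ∀ x → MAdj G x x ≡ false
  MAdj-irrefl (inj₁ i)        = Graph.irrefl G i
  MAdj-irrefl (inj₂ (inj₁ i)) = refl
  MAdj-irrefl (inj₂ (inj₂ _)) = refl

  open WalkLabelling (≡-dec _≟_ (≡-dec _≟_ Unit._≟_)) (MAdj G) MAdj-sym MAdj-irrefl
  open CliquePairing A

  blocks : List (Fin n) → List (MVert n)
  blocks []           = []
  blocks (y ∷ [])     = copy y ∷ base y ∷ []
  blocks (y ∷ z ∷ zs) = copy y ∷ base y ∷ base z ∷ copy z ∷ blocks zs

  schedule : Fin n → List (Fin n) → List (MVert n)
  schedule a ys = base a ∷ copy a ∷ blocks ys

  adjacentPairs : List (Fin n) → ℕ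
  adjacentPairs []           = 0
  adjacentPairs (y ∷ [])     = 0
  adjacentPairs (y ∷ z ∷ zs) = ⟦ A y z ⟧ + adjacentPairs zs

  span-blocks : ∀ x ys → span (copy x) (blocks ys) ≡ 2 * length ys + adjacentPairs ys
  span-blocks x []           = refl
  span-blocks x (y ∷ [])     rewrite Graph.irrefl G y = refl
  span-blocks x (y ∷ z ∷ zs) rewrite Graph.irrefl G y | Graph.irrefl G z | span-blocks z zs =
    arith ⟦ A y z ⟧ (length zs) (adjacentPairs zs)
    where
    arith : ∀ e l p → 1 + (1 + (suc e + (1 + (2 * l + p)))) ≡ 2 * suc (suc l) + (e + p)
    arith = solve-∀

  span-schedule : ∀ a ys → span apex (schedule a ys) ≡ 2 * length (a ∷ ys) + adjacentPairs ys
  span-schedule a ys rewrite Graph.irrefl G a | span-blocks a ys = arith (length ys) (adjacentPairs ys)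
    where
    arith : ∀ l p → 1 + (1 + (2 * l + p)) ≡ 2 * suc l + p
    arith = solve-∀

  ∈-blocks : ∀ {x ys} → x ∈ ys → base x ∈ blocks ys × copy x ∈ blocks ys
  ∈-blocks {ys = y ∷ []}     (here refl)         = there (here refl) , here refl
  ∈-blocks {ys = y ∷ z ∷ zs} (here refl)         = there (here refl) , here refl
  ∈-blocks {ys = y ∷ z ∷ zs} (there (here refl)) = there (there (here refl)) , there (there (there (here refl)))
  ∈-blocks {ys = y ∷ z ∷ zs} (there (there x∈))  = Product.map skip4 skip4 (∈-blocks x∈)
    where
    skip4 : ∀ {w} → w ∈ blocks zs → w ∈ copy y ∷ base y ∷ base z ∷ copy z ∷ blocks zs
    skip4 = there ∘ there ∘ there ∘ there

  schedule-visits : ∀ {a ys} → (∀ x → x ∈ a ∷ ys) → ∀ z → z ∈ apex ∷ schedule a ys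
  schedule-visits visits (inj₂ (inj₂ tt)) = here refl
  schedule-visits visits (inj₁ x) with visits x
  ... | here refl = there (here refl)
  ... | there x∈  = there (there (there (proj₁ (∈-blocks x∈))))
  schedule-visits visits (inj₂ (inj₁ x)) with visits x
  ... | here refl = there (there (here refl))
  ... | there x∈  = there (there (there (proj₂ (∈-blocks x∈))))

  schedule-labelling : ∀ {k} a ys → a ∷ ys ↭ allFin n → 2 * n + adjacentPairs ys ≤ k →
                       LambdaAtMost (MAdj G) k
  schedule-labelling {k} a ys σ bound =
    label 0 apex (schedule a ys) , walk-isL21 0 apex (schedule a ys) (schedule-visits visits) , label≤k
    where
    visits : ∀ x → x ∈ a ∷ ys
    visits x = ∈-resp-↭ (↭-sym σ) (∈-allFin x)
    label≤k : ∀ z → label 0 apex (schedule a ys) z ≤ k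
    label≤k z = begin
      label 0 apex (schedule a ys) z
        ≤⟨ label≤span 0 apex (schedule a ys) z ⟩
      span apex (schedule a ys)
        ≡⟨ span-schedule a ys ⟩
      2 * length (a ∷ ys) + adjacentPairs ys
        ≡⟨ cong (λ l → 2 * l + adjacentPairs ys) (trans (↭-length σ) (length-tabulate {n = n} id)) ⟩
      2 * n + adjacentPairs ys
        ≤⟨ bound ⟩
      k ∎
      where open ≤-Reasoning

  adjacentPairs≤length : ∀ ys → adjacentPairs ys ≤ length ys
  adjacentPairs≤length []           = z≤n
  adjacentPairs≤length (y ∷ [])     = z≤n
  adjacentPairs≤length (y ∷ z ∷ zs) =
    ≤-trans (+-mono-≤ (⟦⟧≤1 (A y z)) (adjacentPairs≤length zs)) (n≤1+n _)

  adjacentPairs-unpair : ∀ {P} ys → All (λ (p , q) → A p q ≡ false) P →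
                         adjacentPairs (unpair P ++ ys) ≡ adjacentPairs ys
  adjacentPairs-unpair ys []                 = refl
  adjacentPairs-unpair ys (nonadj ∷ nonadjs) rewrite nonadj = adjacentPairs-unpair ys nonadjs

  clique-triangles : ∀ {r l m ys} → AllPairs Adjacent (r ∷ l ∷ m ∷ ys) → All (InTriangleWith G r) (l ∷ m ∷ ys)
  clique-triangles {r} {l} {m} ((r~l ∷ r~rest) ∷ (l~m ∷ l~rest) ∷ _) =
    (r~l , m , l~m , All.head r~rest)
    ∷ All.tabulate (λ w∈ → All.lookup r~rest w∈ , l
                         , trans (Graph.sym G _ l) (All.lookup (l~m ∷ l~rest) w∈) , r~l)

  doubled-moore-bound : DiameterAtMost2 G → Fin n → 2 * n + 0 ≤ 2 * (Δ ^ 2 + 1)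
  doubled-moore-bound diam v = double-bound n z≤n (refined-moore-bound G diam v [] [])

  clique-bound : DiameterAtMost2 G → ∀ r ys → AllPairs Adjacent (r ∷ ys) →
                 2 * n + adjacentPairs ys ≤ 2 * (Δ ^ 2 + 1)
  clique-bound diam r []             _              = doubled-moore-bound diam r
  clique-bound diam r (_ ∷ [])       _              = doubled-moore-bound diam r
  clique-bound diam r ys@(_ ∷ _ ∷ _) clq@(_ ∷ clq′) =
    double-bound n (adjacentPairs≤length ys)
      (refined-moore-bound G diam r (AllPairs.map (adjacent⇒≢ (Graph.irrefl G)) clq′) (clique-triangles clq))

  few-adjacentPairs-ordering : DiameterAtMost2 G → Fin n →
    ∃₂ λ a ys → a ∷ ys ↭ allFin n × 2 * n + adjacentPairs ys ≤ 2 * (Δ ^ 2 + 1)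
  few-adjacentPairs-ordering diam x with cliqueAndPairs (allFin n)
  ... | record { pairs = P ; clique = r ∷ ys ; pairs-nonadjacent = nonadj ; clique-isClique = clq ; partition = σ } =
    r , unpair P ++ ys , ↭-trans (↭-sym (shift r (unpair P) ys)) σ ,
    subst (λ e → 2 * n + e ≤ _) (sym (adjacentPairs-unpair ys nonadj)) (clique-bound diam r ys clq)
  ... | record { pairs = (p , q) ∷ P ; clique = [] ; pairs-nonadjacent = _ ∷ nonadj ; partition = σ } =
    p , unpair P ++ q ∷ [] , ↭-trans (↭-prep p (shift q (unpair P) [])) σ ,
    subst (λ e → 2 * n + e ≤ _) (sym (adjacentPairs-unpair (q ∷ []) nonadj)) (doubled-moore-bound diam p)
  ... | record { pairs = [] ; clique = [] ; partition = σ } with () ← ∈-resp-↭ (↭-sym σ) (∈-allFin x)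

corollary3p1 : ∀ (n : ℕ) (G : Graph n) → Diameter2 G →
    LambdaAtMost (MAdj G) (2 * (maxDegree G ^ 2 + 1))
corollary3p1 n G (diam , x , _) with few-adjacentPairs-ordering G diam x
... | a , ys , σ , bound = schedule-labelling G a ys σ bound
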